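{- Let $G$ be a graph with spanning tree $T$, let $\nu$ be a cluster with spine $\pi(\nu)$ and associated subgraph $G[\nu]$ (which contains all edges of $\pi(\nu)$). For every maximal biconnected component $B$ of $G[\nu]$, if $B\cap\pi(\nu)$ is nonempty then it is a path (possibly consisting of a single vertex), i.e. a contiguous subpath of $\pi(\nu)$.
   Context: A cluster is a connected subgraph of the spanning tree $T$ with at most two boundary vertices (vertices incident to an edge of $T$ outside the cluster). For a path cluster (two boundary vertices $u,v$) the spine $\pi(\nu)$ is the $u$–$v$ path in $T$; for a point cluster (one boundary vertex $u$) the spine is the single vertex $u$. The subgraph $G[\nu]$ consists of the edges of $G$ with both endpoints in the vertex set of $\nu$ (for a path cluster, excluding non-tree edges incident to the boundary vertices); in particular it contains the spine. A maximal biconnected component (block) of a graph is a maximal subgraph that is either a single edge (bridge) or 2-vertex-connected. -}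

module Defs where

open import Data.Nat using (ℕ; _≤_)
open import Data.Fin using (Fin; _≟_)
open import Data.Bool using (Bool; true; false; _∧_; _∨_; not)
open import Data.Maybe using (just)
open import Data.List using (List; []; _∷_; _++_; length; head; last)
open import Data.List.Relation.Unary.All using (All)
open import Data.List.Relation.Unary.Any using (Any)
open import Data.List.Relation.Unary.Linked using (Linked)
open import Data.List.Relation.Unary.Unique.Propositional using (Unique)
open import Data.Product using (Σ; ∃; _×_; _,_)
open import Data.Sum using (_⊎_)
open import Relation.Binary.PropositionalEquality using (_≡_; _≢_)
open import Relation.Nullary using (¬_)
open import Relation.Nullary.Decidable using (⌊_⌋)

VSet : ℕ → Set
VSet n = Fin n → Bool

ESet : ℕ → Set
ESet n = Fin n → Fin n → Bool

record Graph (n : ℕ) : Set where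
  field
    adj    : ESet n
    sym    : ∀ x y → adj x y ≡ adj y x
    irrefl : ∀ x → adj x x ≡ false
open Graph public

Symmetric : ∀ {n} → ESet n → Set
Symmetric E = ∀ x y → E x y ≡ E y x

IsPath : ∀ {n} → ESet n → Fin n → Fin n → List (Fin n) → Set
IsPath E u v p =
  Linked (λ x y → E x y ≡ true) p × Unique p × head p ≡ just u × last p ≡ just v

IsCycle : ∀ {n} → ESet n → List (Fin n) → Set
IsCycle E c =
  3 ≤ length c × Unique c × Linked (λ x y → E x y ≡ true) c ×
  ∃ λ x → ∃ λ y → head c ≡ just x × last c ≡ just y × E y x ≡ true

Connected : ∀ {n} → VSet n → ESet n → Set
Connected V E = ∀ x y → V x ≡ true → V y ≡ true →
  ∃ λ p → IsPath E x y p × All (λ z → V z ≡ true) p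

full : ∀ {n} → VSet n
full _ = true

IsSpanningTree : ∀ {n} → Graph n → ESet n → Set
IsSpanningTree G T =
  Symmetric T ×
  (∀ x y → T x y ≡ true → adj G x y ≡ true) ×
  Connected full T ×
  (∀ c → ¬ IsCycle T c)

restrict : ∀ {n} → VSet n → ESet n → ESet n
restrict C E x y = C x ∧ C y ∧ E x y

IsBoundary : ∀ {n} → ESet n → VSet n → Fin n → Set
IsBoundary T C x = C x ≡ true × ∃ λ y → T x y ≡ true × C y ≡ false

IsPointCluster : ∀ {n} → ESet n → VSet n → Fin n → Set
IsPointCluster T C u =
  Connected C (restrict C T) × IsBoundary T C u ×
  (∀ x → IsBoundary T C x → x ≡ u)

IsPathCluster : ∀ {n} → ESet n → VSet n → Fin n → Fin n → Set
IsPathCluster T C u v =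
  Connected C (restrict C T) × u ≢ v × IsBoundary T C u × IsBoundary T C v ×
  (∀ x → IsBoundary T C x → x ≡ u ⊎ x ≡ v)

pointEdges : ∀ {n} → Graph n → VSet n → ESet n
pointEdges G C x y = C x ∧ C y ∧ adj G x y

isUV : ∀ {n} → Fin n → Fin n → Fin n → Bool
isUV u v x = ⌊ x ≟ u ⌋ ∨ ⌊ x ≟ v ⌋

pathEdges : ∀ {n} → Graph n → ESet n → VSet n → Fin n → Fin n → ESet n
pathEdges G T C u v x y =
  C x ∧ C y ∧ adj G x y ∧ (T x y ∨ (not (isUV u v x) ∧ not (isUV u v y)))

-- ClusterData G T C spine E : C is the vertex set of a cluster ν (w.r.t. the
-- spanning tree T of G) with spine π(ν) = spine (as a vertex list) and
-- G[ν] = (C , E).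
data ClusterData {n} (G : Graph n) (T : ESet n) (C : VSet n)
     : List (Fin n) → ESet n → Set where
  point : ∀ u → IsPointCluster T C u →
          ClusterData G T C (u ∷ []) (pointEdges G C)
  path  : ∀ u v p → IsPathCluster T C u v → IsPath T u v p →
          ClusterData G T C p (pathEdges G T C u v)

_⊆V_ : ∀ {n} → VSet n → VSet n → Set
A ⊆V B = ∀ x → A x ≡ true → B x ≡ true

_⊆E_ : ∀ {n} → ESet n → ESet n → Set
A ⊆E B = ∀ x y → A x y ≡ true → B x y ≡ true

IsSubgraph : ∀ {n} → VSet n → ESet n → VSet n → ESet n → Set
IsSubgraph BV BE V E =
  BV ⊆V V × BE ⊆E E × Symmetric BE ×
  (∀ x y → BE x y ≡ true → BV x ≡ true × BV y ≡ true)

IsSingleEdge : ∀ {n} → VSet n → ESet n → Set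
IsSingleEdge BV BE = ∃ λ x → ∃ λ y →
  x ≢ y × BV x ≡ true × BV y ≡ true × BE x y ≡ true ×
  (∀ z → BV z ≡ true → z ≡ x ⊎ z ≡ y) ×
  (∀ a b → BE a b ≡ true → (a ≡ x × b ≡ y) ⊎ (a ≡ y × b ≡ x))

removeV : ∀ {n} → Fin n → VSet n → VSet n
removeV w V z = V z ∧ not ⌊ z ≟ w ⌋

removeE : ∀ {n} → Fin n → ESet n → ESet n
removeE w E a b = E a b ∧ not ⌊ a ≟ w ⌋ ∧ not ⌊ b ≟ w ⌋

Is2Connected : ∀ {n} → VSet n → ESet n → Set
Is2Connected BV BE =
  (∃ λ x → ∃ λ y → ∃ λ z → x ≢ y × y ≢ z × x ≢ z ×
     BV x ≡ true × BV y ≡ true × BV z ≡ true) ×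
  Connected BV BE ×
  (∀ w → BV w ≡ true → Connected (removeV w BV) (removeE w BE))

IsBiconnected : ∀ {n} → VSet n → ESet n → Set
IsBiconnected BV BE = IsSingleEdge BV BE ⊎ Is2Connected BV BE

IsBlock : ∀ {n} → VSet n → ESet n → VSet n → ESet n → Set
IsBlock V E BV BE =
  IsSubgraph BV BE V E × IsBiconnected BV BE ×
  (∀ BV' BE' → IsSubgraph BV' BE' V E → IsBiconnected BV' BE' →
     BV ⊆V BV' → BE ⊆E BE' → BV' ⊆V BV × BE' ⊆E BE)

IsContiguousSubpath : ∀ {n} → VSet n → ESet n → List (Fin n) → Set
IsContiguousSubpath BV BE spine = ∃ λ pre → ∃ λ mid → ∃ λ post →
  spine ≡ pre ++ mid ++ post × mid ≢ [] ×
  All (λ x → BV x ≡ false) pre × All (λ x → BV x ≡ true) mid ×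
  All (λ x → BV x ≡ false) post ×
  Linked (λ x y → BE x y ≡ true) mid

{-# OPTIONS --safe #-}
module Submission where

-- The spine lies inside the cluster: a path of the tree T whose ends lie in a
-- subtree cannot leave it, since the part outside the subtree together with the
-- subtree path between the exit and re-entry points would be a cycle of T.  So
-- the spine edges, being tree edges, are edges of G[ν].  If a block B met the
-- spine in a and b while the spine segment between them avoided B, that segment
-- would be an ear of B; a biconnected graph with an ear attached is again
-- biconnected, so maximality of B forces the ear to be a single edge ab of B.
-- Hence B meets the spine in a run of consecutive vertices joined by edges of B.

open import Defs hiding (sym)
open import Data.Nat using (ℕ; s≤s; z≤n; _≤_)
open import Data.Nat.Properties using (m≤n⇒m≤1+n)
open import Data.Fin using (Fin; _≟_)
open import Data.Bool using (true; false; _∧_; _∨_; not)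
open import Data.Bool.Properties using (∧-comm; ∨-comm; ∨-zeroʳ)
open import Data.Maybe using (just)
open import Data.Maybe.Properties using (just-injective)
open import Data.List using (List; []; _∷_; _++_; _∷ʳ_; length; head; last)
open import Data.List.Properties using (++-assoc; ∷-injectiveˡ)
open import Data.List.Relation.Unary.All using (All; []; _∷_)
import Data.List.Relation.Unary.All as All
import Data.List.Relation.Unary.All.Properties as All
open import Data.List.Relation.Unary.Any using (Any; here; there)
open import Data.List.Relation.Unary.Linked using (Linked; []; [-]; _∷_)
import Data.List.Relation.Unary.Linked as Linked
open import Data.List.Relation.Unary.Unique.Propositional using (Unique; []; _∷_)
import Data.List.Relation.Unary.Unique.Propositional.Properties as Unique
open import Data.List.Relation.Binary.Disjoint.Propositional using (Disjoint)
open import Data.List.Membership.Propositional using (_∈_; _∉_)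
open import Data.List.Membership.Propositional.Properties using (∈-∃++; ∈-++⁺ˡ; ∈-++⁺ʳ; ∈-++⁻)
import Data.List.Membership.DecPropositional as DecMembership
open import Data.Product using (∃; _×_; _,_; proj₁; proj₂)
import Data.Product as Product
open import Data.Sum using (_⊎_; inj₁; inj₂; [_,_]; swap)
import Data.Sum as Sum
open import Data.Empty using (⊥-elim)
open import Function using (_∘_; _∘′_)
open import Relation.Binary.PropositionalEquality using (_≡_; _≢_; refl; sym; trans; cong; cong₂; subst)
open import Relation.Nullary using (¬_; Dec; yes; no)
open import Relation.Nullary.Decidable using (⌊_⌋)

≡true⊎≡false : ∀ b → b ≡ true ⊎ b ≡ false
≡true⊎≡false true  = inj₁ refl
≡true⊎≡false false = inj₂ refl

≡true⇒≢false : ∀ {b} → b ≡ true → b ≢ false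
≡true⇒≢false refl ()

∧-true⁻ : ∀ {a b} → a ∧ b ≡ true → a ≡ true × b ≡ true
∧-true⁻ {true} b≡true = refl , b≡true

∧-true⁺ : ∀ {a b} → a ≡ true → b ≡ true → a ∧ b ≡ true
∧-true⁺ refl b≡true = b≡true

∨-true⁻ : ∀ {a b} → a ∨ b ≡ true → a ≡ true ⊎ b ≡ true
∨-true⁻ {true}  _       = inj₁ refl
∨-true⁻ {false} b≡true = inj₂ b≡true

∨-true⁺ˡ : ∀ {a b} → a ≡ true → a ∨ b ≡ true
∨-true⁺ˡ refl = refl

∨-true⁺ʳ : ∀ {a b} → b ≡ true → a ∨ b ≡ true
∨-true⁺ʳ {a} refl = ∨-zeroʳ a

isYes-true⁻ : ∀ {P : Set} (P? : Dec P) → ⌊ P? ⌋ ≡ true → P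
isYes-true⁻ (yes p) _ = p

isYes-true⁺ : ∀ {P : Set} (P? : Dec P) → P → ⌊ P? ⌋ ≡ true
isYes-true⁺ (yes _)  _ = refl
isYes-true⁺ (no ¬p) p = ⊥-elim (¬p p)

module _ {n : ℕ} {w : Fin n} where

  removeV⁺ : ∀ {V : VSet n} {z} → V z ≡ true → z ≢ w → removeV w V z ≡ true
  removeV⁺ {z = z} z∈V z≢w with z ≟ w
  ... | yes z≡w = ⊥-elim (z≢w z≡w)
  ... | no _    rewrite z∈V = refl

  removeV⁻ : ∀ {V : VSet n} {z} → removeV w V z ≡ true → V z ≡ true × z ≢ w
  removeV⁻ {V} {z} z∈V-w with z ≟ w | ∧-true⁻ {V z} z∈V-w
  ... | no z≢w | z∈V , _ = z∈V , z≢w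

  removeE⁺ : ∀ {E : ESet n} {x y} → E x y ≡ true → x ≢ w → y ≢ w → removeE w E x y ≡ true
  removeE⁺ {x = x} {y} xy∈E x≢w y≢w with x ≟ w | y ≟ w
  ... | yes x≡w | _       = ⊥-elim (x≢w x≡w)
  ... | no _    | yes y≡w = ⊥-elim (y≢w y≡w)
  ... | no _    | no _    rewrite xy∈E = refl

  removeE-sym : ∀ {E : ESet n} → Symmetric E → Symmetric (removeE w E)
  removeE-sym E-sym x y = cong₂ _∧_ (E-sym x y) (∧-comm (not ⌊ x ≟ w ⌋) (not ⌊ y ≟ w ⌋))

module _ {A : Set} where

  last-++-∷ : ∀ xs (y : A) ys → last (xs ++ y ∷ ys) ≡ last (y ∷ ys)
  last-++-∷ []           y ys = refl
  last-++-∷ (x ∷ [])     y ys = refl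
  last-++-∷ (x ∷ x′ ∷ xs) y ys = last-++-∷ (x′ ∷ xs) y ys

  last-∷-just : ∀ (x : A) xs → ∃ λ y → last (x ∷ xs) ≡ just y
  last-∷-just x []        = x , refl
  last-∷-just x (x′ ∷ xs) = last-∷-just x′ xs

  last⇒∈ : ∀ {xs} {y : A} → last xs ≡ just y → y ∈ xs
  last⇒∈ {x ∷ []}     refl = here refl
  last⇒∈ {x ∷ x′ ∷ xs} eq  = there (last⇒∈ {x′ ∷ xs} eq)

  head-∷ʳ-++ : ∀ xs (x : A) ys zs → head ((xs ∷ʳ x) ++ ys) ≡ head ((xs ∷ʳ x) ++ zs)
  head-∷ʳ-++ []      x ys zs = refl
  head-∷ʳ-++ (_ ∷ _) x ys zs = refl

  3≤length-∷ʳ-++ : ∀ xs (x a b : A) ys → 3 ≤ length ((xs ∷ʳ x) ++ a ∷ b ∷ ys)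
  3≤length-∷ʳ-++ []       x a b ys = s≤s (s≤s (s≤s z≤n))
  3≤length-∷ʳ-++ (_ ∷ xs) x a b ys = m≤n⇒m≤1+n (3≤length-∷ʳ-++ xs x a b ys)

module _ {A : Set} {R : A → A → Set} where

  Linked-++⁻ˡ : ∀ xs {ys} → Linked R (xs ++ ys) → Linked R xs
  Linked-++⁻ˡ []            _         = []
  Linked-++⁻ˡ (x ∷ [])      _         = [-]
  Linked-++⁻ˡ (x ∷ x′ ∷ xs) (r ∷ rs) = r ∷ Linked-++⁻ˡ (x′ ∷ xs) rs

  Linked-++⁻ʳ : ∀ xs {ys} → Linked R (xs ++ ys) → Linked R ys
  Linked-++⁻ʳ []       rs = rs
  Linked-++⁻ʳ (x ∷ xs) rs = Linked-++⁻ʳ xs (Linked.tail rs)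

  Linked-∷ʳ-++⁻ : ∀ xs {x y ys} → Linked R ((xs ∷ʳ x) ++ y ∷ ys) → R x y
  Linked-∷ʳ-++⁻ []       rs = Linked.head rs
  Linked-∷ʳ-++⁻ (_ ∷ xs) rs = Linked-∷ʳ-++⁻ xs (Linked.tail rs)

  Linked-splice : ∀ xs {z ys zs} → Linked R (xs ++ z ∷ ys) → Linked R (z ∷ zs) → Linked R (xs ++ z ∷ zs)
  Linked-splice []            _        rs′ = rs′
  Linked-splice (x ∷ [])      (r ∷ _)  rs′ = r ∷ rs′
  Linked-splice (x ∷ x′ ∷ xs) (r ∷ rs) rs′ = r ∷ Linked-splice (x′ ∷ xs) rs rs′

  Linked-map-All : ∀ {P : A → Set} {S : A → A → Set} → (∀ {x y} → P x → P y → R x y → S x y) →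
                ∀ {xs} → All P xs → Linked R xs → Linked S xs
  Linked-map-All f _                  []       = []
  Linked-map-All f _                  [-]      = [-]
  Linked-map-All f (px ∷ pxs@(py ∷ _)) (r ∷ rs) = f px py r ∷ Linked-map-All f pxs rs

module _ {A : Set} where

  Unique-++⁻ˡ : ∀ xs {ys : List A} → Unique (xs ++ ys) → Unique xs
  Unique-++⁻ˡ []       _        = []
  Unique-++⁻ˡ (x ∷ xs) (x∉ ∷ u) = All.++⁻ˡ xs x∉ ∷ Unique-++⁻ˡ xs u

  Unique-++⁻ʳ : ∀ xs {ys : List A} → Unique (xs ++ ys) → Unique ys
  Unique-++⁻ʳ []       u       = u
  Unique-++⁻ʳ (x ∷ xs) (_ ∷ u) = Unique-++⁻ʳ xs u

  Unique-++⇒Disjoint : ∀ xs {ys : List A} → Unique (xs ++ ys) → Disjoint xs ys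
  Unique-++⇒Disjoint (x ∷ xs) (x∉ ∷ _) (here refl , v∈ys) = All.lookup (All.++⁻ʳ xs x∉) v∈ys refl
  Unique-++⇒Disjoint (x ∷ xs) (_ ∷ u)  (there v∈xs , v∈ys) = Unique-++⇒Disjoint xs u (v∈xs , v∈ys)

module _ {A : Set} {P Q : A → Set} (P⊎Q : ∀ x → P x ⊎ Q x) where

  all⊎first : ∀ xs → All P xs ⊎ ∃ λ pre → ∃ λ y → ∃ λ post → xs ≡ pre ++ y ∷ post × All P pre × Q y
  all⊎first []       = inj₁ []
  all⊎first (x ∷ xs) with P⊎Q x
  ... | inj₂ qx = inj₂ ([] , x , xs , refl , [] , qx)
  ... | inj₁ px with all⊎first xs
  ...   | inj₁ pxs                             = inj₁ (px ∷ pxs)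
  ...   | inj₂ (pre , y , post , refl , ppre , qy) = inj₂ (x ∷ pre , y , post , refl , px ∷ ppre , qy)

  all⊎exit : ∀ {x} xs → P x → All P (x ∷ xs) ⊎
             ∃ λ pre → ∃ λ y → ∃ λ z → ∃ λ post → x ∷ xs ≡ (pre ∷ʳ y) ++ z ∷ post × All P (pre ∷ʳ y) × Q z
  all⊎exit []       px = inj₁ (px ∷ [])
  all⊎exit (x′ ∷ xs) px with P⊎Q x′
  ... | inj₂ qx′ = inj₂ ([] , _ , x′ , xs , refl , px ∷ [] , qx′)
  ... | inj₁ px′ with all⊎exit xs px′
  ...   | inj₁ pxs                                  = inj₁ (px ∷ pxs)
  ...   | inj₂ (pre , y , z , post , eq , ppre , qz) = inj₂ (_ ∷ pre , y , z , post , cong (_ ∷_) eq , px ∷ ppre , qz)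

-- Walks

module _ {n : ℕ} where

  data Walk (V : VSet n) (E : ESet n) : Fin n → Fin n → Set where
    halt : ∀ {x}     → V x ≡ true → Walk V E x x
    step : ∀ {x y z} → V x ≡ true → E x y ≡ true → Walk V E y z → Walk V E x z

  walk-mono : ∀ {V V′ : VSet n} {E E′ : ESet n} → V ⊆V V′ → E ⊆E E′ →
              ∀ {x y} → Walk V E x y → Walk V′ E′ x y
  walk-mono V⊆ E⊆ (halt x∈V)        = halt (V⊆ _ x∈V)
  walk-mono V⊆ E⊆ (step x∈V xy∈E w) = step (V⊆ _ x∈V) (E⊆ _ _ xy∈E) (walk-mono V⊆ E⊆ w)

module _ {n : ℕ} {V : VSet n} {E : ESet n} where
  open DecMembership {A = Fin n} _≟_ using (_∈?_)

  walk-++ : ∀ {x y z} → Walk V E x y → Walk V E y z → Walk V E x z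
  walk-++ (halt _)          w′ = w′
  walk-++ (step x∈V xy∈E w) w′ = step x∈V xy∈E (walk-++ w w′)

  walk-∷ʳ : ∀ {x y z} → Walk V E x y → E y z ≡ true → V z ≡ true → Walk V E x z
  walk-∷ʳ w yz∈E z∈V = walk-++ w (step (walk-end w) yz∈E (halt z∈V))
    where
    walk-end : ∀ {x y} → Walk V E x y → V y ≡ true
    walk-end (halt y∈V)     = y∈V
    walk-end (step _ _ w′)  = walk-end w′

  walk-reverse : Symmetric E → ∀ {x y} → Walk V E x y → Walk V E y x
  walk-reverse E-sym (halt x∈V)        = halt x∈V
  walk-reverse E-sym (step x∈V xy∈E w) = walk-∷ʳ (walk-reverse E-sym w) (trans (E-sym _ _) xy∈E) x∈V

  walk-to-last : ∀ {xs z y} → Linked (λ a b → E a b ≡ true) xs → All (λ a → V a ≡ true) xs →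
                 z ∈ xs → last xs ≡ just y → Walk V E z y
  walk-to-last [-]      (z∈V ∷ []) (here refl) refl = halt z∈V
  walk-to-last (e ∷ lk) (z∈V ∷ vs) (here refl) l≡y  = step z∈V e (walk-to-last lk vs (here refl) l≡y)
  walk-to-last (_ ∷ lk) (_ ∷ vs)   (there z∈)  l≡y  = walk-to-last lk vs z∈ l≡y

  walk-to-head : Symmetric E → ∀ {xs z y} → Linked (λ a b → E a b ≡ true) xs → All (λ a → V a ≡ true) xs →
                 z ∈ xs → head xs ≡ just y → Walk V E z y
  walk-to-head E-sym {x ∷ xs} lk vs z∈ refl with last-∷-just x xs
  ... | y , l≡y = walk-++ (walk-to-last lk vs z∈ l≡y) (walk-reverse E-sym (walk-to-last lk vs (here refl) l≡y))

  path⇒walk : ∀ {x y p} → IsPath E x y p → All (λ a → V a ≡ true) p → Walk V E x y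
  path⇒walk {p = _ ∷ _} (lk , _ , refl , last≡y) vs = walk-to-last lk vs (here refl) last≡y

  suffix-path : ∀ {x u y p} → x ∈ p → IsPath E u y p → All (λ a → V a ≡ true) p →
                ∃ λ q → IsPath E x y q × All (λ a → V a ≡ true) q
  suffix-path {x} {p = p} x∈p (lk , u , _ , last≡) vs with ∈-∃++ x∈p
  ... | pre , post , p≡ =
    x ∷ post ,
    (Linked-++⁻ʳ pre (subst (Linked _) p≡ lk) , Unique-++⁻ʳ pre (subst Unique p≡ u) , refl ,
     trans (sym (last-++-∷ pre x post)) (trans (cong last (sym p≡)) last≡)) ,
    All.++⁻ʳ pre (subst (All _) p≡ vs)

  walk⇒path : ∀ {x y} → Walk V E x y → ∃ λ p → IsPath E x y p × All (λ a → V a ≡ true) p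
  walk⇒path (halt x∈V) = _ ∷ [] , ([-] , [] ∷ [] , refl , refl) , x∈V ∷ []
  walk⇒path {x} (step x∈V xy∈E w) with walk⇒path w
  ... | p@(_ ∷ _) , q@(lk , u , refl , last≡) , vs with x ∈? p
  ...   | no x∉p  = x ∷ p , (xy∈E ∷ lk , All.¬Any⇒All¬ p x∉p ∷ u , refl , last≡) , x∈V ∷ vs
  ...   | yes x∈p = suffix-path x∈p q vs

  connected⇒walk : Connected V E → ∀ {x y} → V x ≡ true → V y ≡ true → Walk V E x y
  connected⇒walk V-conn x∈V y∈V with V-conn _ _ x∈V y∈V
  ... | _ , p , vs = path⇒walk p vs

  connected-via-hub : Symmetric E → ∀ {h} → (∀ z → V z ≡ true → Walk V E z h) → Connected V E
  connected-via-hub E-sym to-h x y x∈V y∈V = walk⇒path (walk-++ (to-h x x∈V) (walk-reverse E-sym (to-h y y∈V)))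

-- Paths in forests

module _ {n : ℕ} {T : ESet n} where

  splice-cycle : ∀ pre {t z post q₁ q₂ x y} →
    let r = (pre ∷ʳ t) ++ z ∷ post ; q = z ∷ q₁ ∷ q₂ in
    Linked (λ a b → T a b ≡ true) r → Unique r → head r ≡ just y →
    Linked (λ a b → T a b ≡ true) q → Unique q → last q ≡ just x → T x y ≡ true →
    Disjoint (pre ∷ʳ t) q → IsCycle T ((pre ∷ʳ t) ++ q)
  splice-cycle pre {t} {z} {post} {q₁} {q₂} {x} {y} lr ur hr lq uq lastq xy∈T disj =
    3≤length-∷ʳ-++ pre t z q₁ q₂ ,
    Unique.++⁺ (Unique-++⁻ˡ (pre ∷ʳ t) ur) uq disj ,
    Linked-splice (pre ∷ʳ t) lr lq ,
    y , x , trans (head-∷ʳ-++ pre t (z ∷ q₁ ∷ q₂) (z ∷ post)) hr ,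
    trans (last-++-∷ (pre ∷ʳ t) z (q₁ ∷ q₂)) lastq , xy∈T

  path-stays-inside : (∀ c → ¬ IsCycle T c) → ∀ {C : VSet n} → Connected C (restrict C T) →
    ∀ {u v p} → IsPath T u v p → C u ≡ true → C v ≡ true → All (λ x → C x ≡ true) p
  path-stays-inside acyclic {C} C-conn {v = v} {p = u ∷ p′} (lk , uniq , refl , last≡v) u∈C v∈C
    -- x is the last vertex before p leaves C, t the last one before it returns at z.
    with all⊎exit (λ x → ≡true⊎≡false (C x)) p′ u∈C
  ... | inj₁ inside = inside
  ... | inj₂ (pre , x , y , post , p≡ , pre-x∈C , y∉C)
    with all⊎exit (λ x → swap (≡true⊎≡false (C x))) post y∉C
  ...   | inj₁ outside = ⊥-elim (≡true⇒≢false v∈C (All.lookup outside (last⇒∈ v-last)))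
    where
    v-last : last (y ∷ post) ≡ just v
    v-last = trans (sym (last-++-∷ (pre ∷ʳ x) y post)) (trans (cong last (sym p≡)) last≡v)
  ...   | inj₂ (pre′ , t , z , post′ , y-post≡ , pre′-t∉C , z∈C)
    with C-conn z x z∈C (proj₂ (All.∷ʳ⁻ pre-x∈C))
  ...     | z ∷ [] , (_ , _ , refl , z≡x) , _ = ⊥-elim (x≢z (just-injective (sym z≡x)))
    where
    x≢z : x ≢ z
    x≢z refl = Unique-++⇒Disjoint (pre ∷ʳ x) (subst Unique p≡ uniq)
      (∈-++⁺ʳ pre (here refl) , subst (z ∈_) (sym y-post≡) (∈-++⁺ʳ (pre′ ∷ʳ t) (here refl)))
  ...     | z ∷ q₁ ∷ q₂ , (lq , uq , refl , lastq) , q∈C =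
    ⊥-elim (acyclic _ (splice-cycle pre′ (subst (Linked _) y-post≡ (Linked-++⁻ʳ (pre ∷ʳ x) lk′))
                                 (subst Unique y-post≡ (Unique-++⁻ʳ (pre ∷ʳ x) (subst Unique p≡ uniq)))
                                 (cong head (sym y-post≡))
                                 (Linked.map (λ {a} {b} e → proj₂ (∧-true⁻ {C b} (proj₂ (∧-true⁻ {C a} e)))) lq)
                                 uq lastq (Linked-∷ʳ-++⁻ pre lk′) disjoint))
    where
    lk′ : Linked (λ a b → T a b ≡ true) ((pre ∷ʳ x) ++ y ∷ post)
    lk′ = subst (Linked _) p≡ lk
    disjoint : Disjoint (pre′ ∷ʳ t) (z ∷ q₁ ∷ q₂)
    disjoint (a∈out , a∈q) = ≡true⇒≢false (All.lookup q∈C a∈q) (All.lookup pre′-t∉C a∈out)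

-- Ears

module _ {n : ℕ} where

  joins : Fin n → Fin n → ESet n
  joins x y c d = (⌊ c ≟ x ⌋ ∧ ⌊ d ≟ y ⌋) ∨ (⌊ c ≟ y ⌋ ∧ ⌊ d ≟ x ⌋)

  edgesOf : List (Fin n) → ESet n
  edgesOf (x ∷ y ∷ xs) c d = joins x y c d ∨ edgesOf (y ∷ xs) c d
  edgesOf _            _ _ = false

  joins-sym : ∀ x y → Symmetric (joins x y)
  joins-sym x y c d =
    trans (cong₂ _∨_ (∧-comm ⌊ c ≟ x ⌋ _) (∧-comm ⌊ c ≟ y ⌋ _)) (∨-comm (⌊ d ≟ y ⌋ ∧ _) (⌊ d ≟ x ⌋ ∧ _))

  joins-refl : ∀ x y → joins x y x y ≡ true
  joins-refl x y = ∨-true⁺ˡ (∧-true⁺ (isYes-true⁺ (x ≟ x) refl) (isYes-true⁺ (y ≟ y) refl))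

  joins⁻ : ∀ {x y c d} → joins x y c d ≡ true → (c ≡ x × d ≡ y) ⊎ (c ≡ y × d ≡ x)
  joins⁻ {x} {y} {c} {d} cd∈ with ∨-true⁻ {⌊ c ≟ x ⌋ ∧ ⌊ d ≟ y ⌋} cd∈
  ... | inj₁ forward  = inj₁ (Product.map (isYes-true⁻ (c ≟ x)) (isYes-true⁻ (d ≟ y)) (∧-true⁻ forward))
  ... | inj₂ backward = inj₂ (Product.map (isYes-true⁻ (c ≟ y)) (isYes-true⁻ (d ≟ x)) (∧-true⁻ backward))

  edgesOf-sym : ∀ xs → Symmetric (edgesOf xs)
  edgesOf-sym []           c d = refl
  edgesOf-sym (x ∷ [])     c d = refl
  edgesOf-sym (x ∷ y ∷ xs) c d = cong₂ _∨_ (joins-sym x y c d) (edgesOf-sym (y ∷ xs) c d)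

  edgesOf-linked : ∀ xs → Linked (λ c d → edgesOf xs c d ≡ true) xs
  edgesOf-linked []           = []
  edgesOf-linked (x ∷ [])     = [-]
  edgesOf-linked (x ∷ y ∷ xs) =
    ∨-true⁺ˡ (joins-refl x y) ∷ Linked.map (λ {c} {d} → ∨-true⁺ʳ {joins x y c d}) (edgesOf-linked (y ∷ xs))

  edgesOf⇒∈ : ∀ xs {c d} → edgesOf xs c d ≡ true → c ∈ xs × d ∈ xs
  edgesOf⇒∈ (x ∷ y ∷ xs) {c} {d} cd∈ = [ ends ∘ joins⁻ , Product.map there there ∘ edgesOf⇒∈ (y ∷ xs) ]
                                          (∨-true⁻ {joins x y c d} cd∈)
    where
    ends : (c ≡ x × d ≡ y) ⊎ (c ≡ y × d ≡ x) → c ∈ x ∷ y ∷ xs × d ∈ x ∷ y ∷ xs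
    ends (inj₁ (refl , refl)) = here refl , there (here refl)
    ends (inj₂ (refl , refl)) = there (here refl) , here refl

  edgesOf⊆ : ∀ {R : Fin n → Fin n → Set} → (∀ {c d} → R c d → R d c) →
             ∀ xs → Linked R xs → ∀ {c d} → edgesOf xs c d ≡ true → R c d
  edgesOf⊆ {R} R-sym (x ∷ y ∷ xs) (r ∷ rs) {c} {d} cd∈ = [ oriented ∘ joins⁻ , edgesOf⊆ R-sym (y ∷ xs) rs ]
                                                           (∨-true⁻ {joins x y c d} cd∈)
    where
    oriented : (c ≡ x × d ≡ y) ⊎ (c ≡ y × d ≡ x) → R c d
    oriented (inj₁ (refl , refl)) = r
    oriented (inj₂ (refl , refl)) = R-sym r

NoCutVertex : ∀ {n} → VSet n → ESet n → Set
NoCutVertex V E = ∀ w → V w ≡ true → Connected (removeV w V) (removeE w E)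

HasThreeVertices : ∀ {n} → VSet n → Set
HasThreeVertices V = ∃ λ x → ∃ λ y → ∃ λ z → x ≢ y × y ≢ z × x ≢ z × V x ≡ true × V y ≡ true × V z ≡ true

module Ear {n : ℕ} {BV : VSet n} {BE : ESet n}
  (BE-sym : Symmetric BE) (BE-ends : ∀ x y → BE x y ≡ true → BV x ≡ true × BV y ≡ true)
  (B-connected : Connected BV BE) (B-noCut : NoCutVertex BV BE)
  {a b : Fin n} {m : List (Fin n)} (a∈B : BV a ≡ true) (b∈B : BV b ≡ true)
  (m∉B : All (λ x → BV x ≡ false) m) (ear-unique : Unique (a ∷ m ++ b ∷ [])) where
  open DecMembership {A = Fin n} _≟_ using (_∈?_)

  ear : List (Fin n)
  ear = a ∷ m ++ b ∷ []

  BV⁺ : VSet n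
  BV⁺ x = BV x ∨ ⌊ x ∈? m ⌋

  BE⁺ : ESet n
  BE⁺ x y = BE x y ∨ edgesOf ear x y

  BV⊆BV⁺ : BV ⊆V BV⁺
  BV⊆BV⁺ _ = ∨-true⁺ˡ

  BE⊆BE⁺ : BE ⊆E BE⁺
  BE⊆BE⁺ _ _ = ∨-true⁺ˡ

  BE⁺-sym : Symmetric BE⁺
  BE⁺-sym x y = cong₂ _∨_ (BE-sym x y) (edgesOf-sym ear x y)

  BV⁺-cases : ∀ {z} → BV⁺ z ≡ true → BV z ≡ true ⊎ z ∈ m
  BV⁺-cases {z} z∈ = Sum.map₂ (isYes-true⁻ (z ∈? m)) (∨-true⁻ {BV z} z∈)

  ear⊆BV⁺ : ∀ {x} → x ∈ ear → BV⁺ x ≡ true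
  ear⊆BV⁺ (here refl) = ∨-true⁺ˡ a∈B
  ear⊆BV⁺ {x} (there x∈) with ∈-++⁻ m x∈
  ... | inj₁ x∈m         = ∨-true⁺ʳ {BV x} (isYes-true⁺ (x ∈? m) x∈m)
  ... | inj₂ (here refl) = ∨-true⁺ˡ b∈B

  ear-linked : Linked (λ x y → BE⁺ x y ≡ true) ear
  ear-linked = Linked.map (λ {x} {y} → ∨-true⁺ʳ {BE x y}) (edgesOf-linked ear)

  a∉ear-tail : a ∉ m ++ b ∷ []
  a∉ear-tail = Unique.Unique[x∷xs]⇒x∉xs ear-unique

  b∉ear-init : b ∉ a ∷ m
  b∉ear-init b∈ = Unique-++⇒Disjoint (a ∷ m) ear-unique (b∈ , here refl)

  a≢b : a ≢ b
  a≢b refl = b∉ear-init (here refl)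

  connected⁺ : Connected BV⁺ BE⁺
  connected⁺ = connected-via-hub BE⁺-sym to-a
    where
    to-a : ∀ z → BV⁺ z ≡ true → Walk BV⁺ BE⁺ z a
    to-a z z∈ with BV⁺-cases z∈
    ... | inj₁ z∈B = walk-mono BV⊆BV⁺ BE⊆BE⁺ (connected⇒walk B-connected z∈B a∈B)
    ... | inj₂ z∈m = walk-to-head BE⁺-sym ear-linked (All.tabulate ear⊆BV⁺) (there (∈-++⁺ˡ z∈m)) refl

  module _ (w : Fin n) where

    Walk⁻ : Fin n → Fin n → Set
    Walk⁻ = Walk (removeV w BV⁺) (removeE w BE⁺)

    segment-survives : ∀ {xs} → Linked (λ x y → BE⁺ x y ≡ true) xs → (∀ {x} → x ∈ xs → BV⁺ x ≡ true) →
                       (∀ {x} → x ∈ xs → x ≢ w) →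
                       Linked (λ x y → removeE w BE⁺ x y ≡ true) xs × All (λ x → removeV w BV⁺ x ≡ true) xs
    segment-survives lk ⊆BV⁺ avoids =
      Linked-map-All (λ x≢w y≢w xy∈ → removeE⁺ {E = BE⁺} xy∈ x≢w y≢w) (All.tabulate avoids) lk ,
      All.tabulate (λ x∈ → removeV⁺ {V = BV⁺} (⊆BV⁺ x∈) (avoids x∈))

    walk⁻-to-last : ∀ {xs z y} → Linked (λ x y → BE⁺ x y ≡ true) xs → (∀ {x} → x ∈ xs → BV⁺ x ≡ true) →
                    (∀ {x} → x ∈ xs → x ≢ w) → z ∈ xs → last xs ≡ just y → Walk⁻ z y
    walk⁻-to-last lk ⊆BV⁺ avoids = let lk⁻ , vs⁻ = segment-survives lk ⊆BV⁺ avoids in walk-to-last lk⁻ vs⁻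

    walk⁻-to-head : ∀ {xs z y} → Linked (λ x y → BE⁺ x y ≡ true) xs → (∀ {x} → x ∈ xs → BV⁺ x ≡ true) →
                    (∀ {x} → x ∈ xs → x ≢ w) → z ∈ xs → head xs ≡ just y → Walk⁻ z y
    walk⁻-to-head lk ⊆BV⁺ avoids =
      let lk⁻ , vs⁻ = segment-survives lk ⊆BV⁺ avoids in walk-to-head (removeE-sym BE⁺-sym) lk⁻ vs⁻

    B-walk⁻-deleting : BV w ≡ true → ∀ {x y} → removeV w BV x ≡ true → removeV w BV y ≡ true → Walk⁻ x y
    B-walk⁻-deleting w∈B x∈ y∈ = walk-mono V⊆ E⊆ (connected⇒walk (B-noCut w w∈B) x∈ y∈)
      where
      V⊆ : removeV w BV ⊆V removeV w BV⁺
      V⊆ z z∈ = let z∈B , z≢w = removeV⁻ {V = BV} z∈ in removeV⁺ {V = BV⁺} (∨-true⁺ˡ z∈B) z≢w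
      E⊆ : removeE w BE ⊆E removeE w BE⁺
      E⊆ x y xy∈ = let xy∈B , rest = ∧-true⁻ {BE x y} xy∈ in ∧-true⁺ {BE⁺ x y} (∨-true⁺ˡ xy∈B) rest

    B-walk⁻-avoiding : BV w ≡ false → ∀ {x y} → BV x ≡ true → BV y ≡ true → Walk⁻ x y
    B-walk⁻-avoiding w∉B x∈ y∈ = walk-mono V⊆ E⊆ (connected⇒walk B-connected x∈ y∈)
      where
      ≢w : ∀ {z} → BV z ≡ true → z ≢ w
      ≢w z∈B refl = ≡true⇒≢false z∈B w∉B
      V⊆ : BV ⊆V removeV w BV⁺
      V⊆ z z∈B = removeV⁺ {V = BV⁺} (∨-true⁺ˡ z∈B) (≢w z∈B)
      E⊆ : BE ⊆E removeE w BE⁺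
      E⊆ x y xy∈ = removeE⁺ {E = BE⁺} (∨-true⁺ˡ xy∈) (≢w (proj₁ (BE-ends x y xy∈))) (≢w (proj₂ (BE-ends x y xy∈)))

  private
    deleted-cases : ∀ {w z} → removeV w BV⁺ z ≡ true → (BV z ≡ true ⊎ z ∈ m) × z ≢ w
    deleted-cases {w} z∈ = let z∈⁺ , z≢w = removeV⁻ {V = BV⁺} z∈ in BV⁺-cases z∈⁺ , z≢w

  -- After deleting a vertex w of B⁺, every remaining vertex still reaches a (b when w = a):
  -- inside B through B or B − w, and along the part of the ear that avoids w.
  to-b-without-a : ∀ z → removeV a BV⁺ z ≡ true → Walk⁻ a z b
  to-b-without-a z z∈ with deleted-cases z∈
  ... | inj₁ z∈B , z≢a = B-walk⁻-deleting a a∈B (removeV⁺ {V = BV} z∈B z≢a) (removeV⁺ {V = BV} b∈B (a≢b ∘ sym))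
  ... | inj₂ z∈m , _   = walk⁻-to-last a (Linked.tail ear-linked) (ear⊆BV⁺ ∘ there)
                           (λ x∈ x≡a → a∉ear-tail (subst (_∈ _) x≡a x∈)) (∈-++⁺ˡ z∈m) (last-++-∷ m b [])

  to-a-without-b : ∀ z → removeV b BV⁺ z ≡ true → Walk⁻ b z a
  to-a-without-b z z∈ with deleted-cases z∈
  ... | inj₁ z∈B , z≢b = B-walk⁻-deleting b b∈B (removeV⁺ {V = BV} z∈B z≢b) (removeV⁺ {V = BV} a∈B a≢b)
  ... | inj₂ z∈m , _   = walk⁻-to-head b (Linked-++⁻ˡ (a ∷ m) ear-linked) (ear⊆BV⁺ ∘ ∈-++⁺ˡ)
                           (λ x∈ x≡b → b∉ear-init (subst (_∈ _) x≡b x∈)) (there z∈m) refl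

  module DeleteInner {w} (m₁ m₂ : List (Fin n)) (m≡ : m ≡ m₁ ++ w ∷ m₂) where

    ear≡ : ear ≡ (a ∷ m₁) ++ w ∷ (m₂ ++ b ∷ [])
    ear≡ = cong (a ∷_) (trans (cong (_++ b ∷ []) m≡) (++-assoc m₁ (w ∷ m₂) (b ∷ [])))

    ∈ear : ∀ {x} → x ∈ (a ∷ m₁) ++ w ∷ (m₂ ++ b ∷ []) → x ∈ ear
    ∈ear {x} = subst (x ∈_) (sym ear≡)

    linked′ : Linked (λ x y → BE⁺ x y ≡ true) ((a ∷ m₁) ++ w ∷ (m₂ ++ b ∷ []))
    linked′ = subst (Linked _) ear≡ ear-linked

    unique′ : Unique ((a ∷ m₁) ++ w ∷ (m₂ ++ b ∷ []))
    unique′ = subst Unique ear≡ ear-unique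

    w∉B : BV w ≡ false
    w∉B = All.lookup m∉B (subst (w ∈_) (sym m≡) (∈-++⁺ʳ m₁ (here refl)))

    to-a-without-inner : ∀ z → removeV w BV⁺ z ≡ true → Walk⁻ w z a
    to-a-without-inner z z∈ with deleted-cases z∈
    ... | inj₁ z∈B , _ = B-walk⁻-avoiding w w∉B z∈B a∈B
    ... | inj₂ z∈m , z≢w with ∈-++⁻ m₁ (subst (z ∈_) m≡ z∈m)
    ...   | inj₁ z∈m₁       =
      walk⁻-to-head w (Linked-++⁻ˡ (a ∷ m₁) linked′) (ear⊆BV⁺ ∘ ∈ear ∘ ∈-++⁺ˡ)
                    (λ x∈ x≡w → Unique-++⇒Disjoint (a ∷ m₁) unique′ (subst (_∈ _) x≡w x∈ , here refl))
                    (there z∈m₁) refl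
    ...   | inj₂ (here z≡w) = ⊥-elim (z≢w z≡w)
    ...   | inj₂ (there z∈m₂) =
      walk-++ (walk⁻-to-last w (Linked.tail (Linked-++⁻ʳ (a ∷ m₁) linked′))
                             (ear⊆BV⁺ ∘ ∈ear ∘ ∈-++⁺ʳ (a ∷ m₁) ∘ there)
                             (λ x∈ x≡w → Unique.Unique[x∷xs]⇒x∉xs (Unique-++⁻ʳ (a ∷ m₁) unique′) (subst (_∈ _) x≡w x∈))
                             (∈-++⁺ˡ z∈m₂) (last-++-∷ m₂ b []))
              (B-walk⁻-avoiding w w∉B b∈B a∈B)

  to-a-without-other : ∀ {w} → BV w ≡ true → w ≢ a → w ≢ b → ∀ z → removeV w BV⁺ z ≡ true → Walk⁻ w z a
  to-a-without-other {w} w∈B w≢a w≢b z z∈ with deleted-cases z∈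
  ... | inj₁ z∈B , z≢w = B-walk⁻-deleting w w∈B (removeV⁺ {V = BV} z∈B z≢w) (removeV⁺ {V = BV} a∈B (w≢a ∘ sym))
  ... | inj₂ z∈m , _   = walk⁻-to-head w ear-linked ear⊆BV⁺ ear-avoids (there (∈-++⁺ˡ z∈m)) refl
    where
    ear-avoids : ∀ {x} → x ∈ ear → x ≢ w
    ear-avoids (here refl) = w≢a ∘ sym
    ear-avoids (there x∈) with ∈-++⁻ m x∈
    ... | inj₁ x∈m         = λ { refl → ≡true⇒≢false w∈B (All.lookup m∉B x∈m) }
    ... | inj₂ (here refl) = w≢b ∘ sym

  noCutVertex⁺ : NoCutVertex BV⁺ BE⁺
  noCutVertex⁺ w w∈ with w ≟ a | w ≟ b | BV⁺-cases w∈
  ... | yes refl | _        | _        = connected-via-hub (removeE-sym BE⁺-sym) to-b-without-a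
  ... | no _     | yes refl | _        = connected-via-hub (removeE-sym BE⁺-sym) to-a-without-b
  ... | no w≢a   | no w≢b   | inj₁ w∈B = connected-via-hub (removeE-sym BE⁺-sym) (to-a-without-other w∈B w≢a w≢b)
  ... | no _     | no _     | inj₂ w∈m with m₁ , m₂ , m≡ ← ∈-∃++ w∈m =
    connected-via-hub (removeE-sym BE⁺-sym) (DeleteInner.to-a-without-inner m₁ m₂ m≡)

  2-connected⁺ : HasThreeVertices BV⁺ → Is2Connected BV⁺ BE⁺
  2-connected⁺ three = three , connected⁺ , noCutVertex⁺

-- Blocks

HasThreeVertices-mono : ∀ {n} {V V′ : VSet n} → V ⊆V V′ → HasThreeVertices V → HasThreeVertices V′
HasThreeVertices-mono V⊆V′ (x , y , z , x≢y , y≢z , x≢z , x∈ , y∈ , z∈) =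
  x , y , z , x≢y , y≢z , x≢z , V⊆V′ x x∈ , V⊆V′ y y∈ , V⊆V′ z z∈

module _ {n : ℕ} {BV : VSet n} {BE : ESet n} where

  singleEdge-adjacent : IsSingleEdge BV BE → Symmetric BE →
                        ∀ {a b} → BV a ≡ true → BV b ≡ true → a ≢ b → BE a b ≡ true
  singleEdge-adjacent (x , y , _ , _ , _ , xy∈ , only , _) BE-sym a∈ b∈ a≢b with only _ a∈ | only _ b∈
  ... | inj₁ refl | inj₁ refl = ⊥-elim (a≢b refl)
  ... | inj₁ refl | inj₂ refl = xy∈
  ... | inj₂ refl | inj₁ refl = trans (BE-sym y x) xy∈
  ... | inj₂ refl | inj₂ refl = ⊥-elim (a≢b refl)

  biconnected⇒connected : Symmetric BE → IsBiconnected BV BE → Connected BV BE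
  biconnected⇒connected BE-sym (inj₂ (_ , connected , _))                = connected
  biconnected⇒connected BE-sym (inj₁ (x , y , _ , x∈ , y∈ , xy∈ , only , _)) = connected-via-hub BE-sym to-x
    where
    to-x : ∀ z → BV z ≡ true → Walk BV BE z x
    to-x z z∈ with only z z∈
    ... | inj₁ refl = halt x∈
    ... | inj₂ refl = step y∈ (trans (BE-sym y x) xy∈) (halt x∈)

  biconnected⇒noCutVertex : IsBiconnected BV BE → NoCutVertex BV BE
  biconnected⇒noCutVertex (inj₂ (_ , _ , noCut)) = noCut
  biconnected⇒noCutVertex (inj₁ (_ , _ , _ , _ , _ , _ , only , _)) w w∈ x y x∈ y∈
    with removeV⁻ {V = BV} x∈ | removeV⁻ {V = BV} y∈
  ... | x∈B , x≢w | y∈B , y≢w with only w w∈ | only x x∈B | only y y∈B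
  ...   | _         | inj₁ refl | inj₁ refl = walk⇒path (halt x∈)
  ...   | _         | inj₂ refl | inj₂ refl = walk⇒path (halt x∈)
  ...   | inj₁ refl | inj₁ refl | _         = ⊥-elim (x≢w refl)
  ...   | inj₂ refl | inj₂ refl | _         = ⊥-elim (x≢w refl)
  ...   | inj₁ refl | _         | inj₁ refl = ⊥-elim (y≢w refl)
  ...   | inj₂ refl | _         | inj₂ refl = ⊥-elim (y≢w refl)

module _ {n : ℕ} {V : VSet n} {E : ESet n} {BV : VSet n} {BE : ESet n}
         (E-sym : Symmetric E) (block : IsBlock V E BV BE) where

  private
    BV⊆V : BV ⊆V V
    BV⊆V = proj₁ (proj₁ block)

    BE⊆E : BE ⊆E E
    BE⊆E = proj₁ (proj₂ (proj₁ block))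

    BE-sym : Symmetric BE
    BE-sym = proj₁ (proj₂ (proj₂ (proj₁ block)))

    BE-ends : ∀ x y → BE x y ≡ true → BV x ≡ true × BV y ≡ true
    BE-ends = proj₂ (proj₂ (proj₂ (proj₁ block)))

    biconnected : IsBiconnected BV BE
    biconnected = proj₁ (proj₂ block)

  module BlockEar {a b : Fin n} {m : List (Fin n)}
    (ear∈E : Linked (λ x y → E x y ≡ true) (a ∷ m ++ b ∷ [])) (ear-unique : Unique (a ∷ m ++ b ∷ []))
    (ear⊆V : All (λ x → V x ≡ true) (a ∷ m ++ b ∷ []))
    (a∈B : BV a ≡ true) (b∈B : BV b ≡ true) (m∉B : All (λ x → BV x ≡ false) m) where

    open Ear BE-sym BE-ends (biconnected⇒connected BE-sym biconnected)
             (biconnected⇒noCutVertex biconnected) a∈B b∈B m∉B ear-unique public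

    subgraph⁺ : IsSubgraph BV⁺ BE⁺ V E
    subgraph⁺ = V⁺⊆V , E⁺⊆E , BE⁺-sym , ends⁺
      where
      V⁺⊆V : BV⁺ ⊆V V
      V⁺⊆V x x∈ with BV⁺-cases x∈
      ... | inj₁ x∈B = BV⊆V x x∈B
      ... | inj₂ x∈m = All.lookup ear⊆V (there (∈-++⁺ˡ x∈m))
      E⁺⊆E : BE⁺ ⊆E E
      E⁺⊆E x y xy∈ with ∨-true⁻ {BE x y} xy∈
      ... | inj₁ xy∈B   = BE⊆E x y xy∈B
      ... | inj₂ xy∈ear = edgesOf⊆ (λ {c} {d} cd∈ → trans (E-sym d c) cd∈) ear ear∈E xy∈ear
      ends⁺ : ∀ x y → BE⁺ x y ≡ true → BV⁺ x ≡ true × BV⁺ y ≡ true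
      ends⁺ x y xy∈ with ∨-true⁻ {BE x y} xy∈
      ... | inj₁ xy∈B   = let x∈ , y∈ = BE-ends x y xy∈B in BV⊆BV⁺ x x∈ , BV⊆BV⁺ y y∈
      ... | inj₂ xy∈ear = let x∈ , y∈ = edgesOf⇒∈ ear xy∈ear in ear⊆BV⁺ x∈ , ear⊆BV⁺ y∈

    absorbed : HasThreeVertices BV⁺ → BV⁺ ⊆V BV × BE⁺ ⊆E BE
    absorbed three = proj₂ (proj₂ block) BV⁺ BE⁺ subgraph⁺ (inj₂ (2-connected⁺ three)) BV⊆BV⁺ BE⊆BE⁺

  block-absorbs-ear : ∀ {a m b} →
    Linked (λ x y → E x y ≡ true) (a ∷ m ++ b ∷ []) → Unique (a ∷ m ++ b ∷ []) → All (λ x → V x ≡ true) (a ∷ m ++ b ∷ []) →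
    BV a ≡ true → BV b ≡ true → All (λ x → BV x ≡ false) m → m ≡ [] × BE a b ≡ true
  block-absorbs-ear {a} {c ∷ m} {b} ear∈E ear-unique ear⊆V a∈B b∈B m∉B@(c∉B ∷ _) =
    ⊥-elim (≡true⇒≢false (proj₁ (absorbed three) c (ear⊆BV⁺ (there (here refl)))) c∉B)
    where
    open BlockEar ear∈E ear-unique ear⊆V a∈B b∈B m∉B
    three : HasThreeVertices BV⁺
    three = a , c , b , (λ { refl → a∉ear-tail (here refl) }) , (λ { refl → b∉ear-init (there (here refl)) }) , a≢b ,
            ear⊆BV⁺ (here refl) , ear⊆BV⁺ (there (here refl)) , ear⊆BV⁺ (there (∈-++⁺ʳ (c ∷ m) (here refl)))
  block-absorbs-ear {a} {[]} {b} ear∈E ear-unique ear⊆V a∈B b∈B m∉B = refl , chord∈B biconnected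
    where
    open BlockEar ear∈E ear-unique ear⊆V a∈B b∈B m∉B
    chord∈B : IsBiconnected BV BE → BE a b ≡ true
    chord∈B (inj₁ single)     = singleEdge-adjacent single BE-sym a∈B b∈B a≢b
    chord∈B (inj₂ (three , _)) = proj₂ (absorbed (HasThreeVertices-mono BV⊆BV⁺ three)) a b (Linked.head ear-linked)

-- Contiguous runs

module _ {n : ℕ} (BV : VSet n) (BE : ESet n) where

  NoGaps : List (Fin n) → Set
  NoGaps p = ∀ pre a m b post → p ≡ pre ++ a ∷ m ++ b ∷ post →
    BV a ≡ true → BV b ≡ true → All (λ x → BV x ≡ false) m → m ≡ [] × BE a b ≡ true

module _ {n : ℕ} {BV : VSet n} {BE : ESet n} where

  noGaps-++⁻ : ∀ xs {p} → NoGaps BV BE (xs ++ p) → NoGaps BV BE p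
  noGaps-++⁻ []       no-gaps = no-gaps
  noGaps-++⁻ (x ∷ xs) no-gaps = noGaps-++⁻ xs (λ pre a m b post → no-gaps (x ∷ pre) a m b post ∘′ cong (x ∷_))

  maximal-run : ∀ a r → BV a ≡ true → NoGaps BV BE (a ∷ r) →
    ∃ λ mid → ∃ λ post → r ≡ mid ++ post ×
      All (λ x → BV x ≡ true) (a ∷ mid) × All (λ x → BV x ≡ false) post × Linked (λ x y → BE x y ≡ true) (a ∷ mid)
  maximal-run a []      a∈B no-gaps = [] , [] , refl , a∈B ∷ [] , [] , [-]
  maximal-run a (c ∷ r) a∈B no-gaps with ≡true⊎≡false (BV c)
  ... | inj₁ c∈B with maximal-run c r c∈B (noGaps-++⁻ (a ∷ []) no-gaps)
  ...   | mid , post , refl , mid∈B , post∉B , linked =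
    c ∷ mid , post , refl , a∈B ∷ mid∈B , post∉B , proj₂ (no-gaps [] a [] c r refl a∈B c∈B []) ∷ linked
  maximal-run a (c ∷ r) a∈B no-gaps | inj₂ c∉B
    with all⊎first (λ x → swap (≡true⊎≡false (BV x))) (c ∷ r)
  ... | inj₁ rest∉B = [] , c ∷ r , refl , a∈B ∷ [] , rest∉B , [-]
  ... | inj₂ (gap , z , post , rest≡ , gap∉B , z∈B) with proj₁ (no-gaps [] a gap z post (cong (a ∷_) rest≡) a∈B z∈B gap∉B)
  ...   | refl = ⊥-elim (≡true⇒≢false (trans (cong BV (∷-injectiveˡ rest≡)) z∈B) c∉B)

  noGaps⇒contiguous : ∀ {p} → NoGaps BV BE p → Any (λ x → BV x ≡ true) p → IsContiguousSubpath BV BE p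
  noGaps⇒contiguous {p} no-gaps hit with all⊎first (λ x → swap (≡true⊎≡false (BV x))) p
  ... | inj₁ p∉B = ⊥-elim (All.All¬⇒¬Any (All.map (λ x∉B x∈B → ≡true⇒≢false x∈B x∉B) p∉B) hit)
  ... | inj₂ (pre , a , r , refl , pre∉B , a∈B) with maximal-run a r a∈B (noGaps-++⁻ pre no-gaps)
  ...   | mid , post , refl , mid∈B , post∉B , linked =
    pre , a ∷ mid , post , refl , (λ ()) , pre∉B , mid∈B , post∉B , linked

-- Clusters

module _ {n : ℕ} (G : Graph n) {T : ESet n} {C : VSet n} {u v : Fin n} where

  pathEdges-sym : Symmetric T → Symmetric (pathEdges G T C u v)
  pathEdges-sym T-sym x y
    rewrite Graph.sym G x y | T-sym x y | ∧-comm (not (isUV u v x)) (not (isUV u v y)) with C x | C y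
  ... | true  | true  = refl
  ... | true  | false = refl
  ... | false | true  = refl
  ... | false | false = refl

  tree-edge∈pathEdges : (∀ x y → T x y ≡ true → adj G x y ≡ true) →
    ∀ {x y} → C x ≡ true → C y ≡ true → T x y ≡ true → pathEdges G T C u v x y ≡ true
  tree-edge∈pathEdges T⊆G {x} {y} x∈C y∈C xy∈T rewrite x∈C | y∈C | T⊆G x y xy∈T | xy∈T = refl

  spine⊆cluster : ∀ {p} → IsSpanningTree G T → IsPathCluster T C u v → IsPath T u v p →
                  All (λ x → C x ≡ true) p
  spine⊆cluster (_ , _ , _ , acyclic) (C-connected , _ , (u∈C , _) , (v∈C , _) , _) spine =
    path-stays-inside acyclic C-connected spine u∈C v∈C

  spine-noGaps : ∀ {BV BE p} → IsSpanningTree G T → IsPathCluster T C u v → IsPath T u v p →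
                 IsBlock C (pathEdges G T C u v) BV BE → NoGaps BV BE p
  spine-noGaps {p = p} tree@(T-sym , T⊆G , _) cluster spine@(spine∈T , spine-unique , _) block
               pre a m b post p≡ =
    block-absorbs-ear (pathEdges-sym T-sym) block
      (Linked-++⁻ˡ ear (Linked-++⁻ʳ pre (subst (Linked _) p≡′ spine∈G[ν])))
      (Unique-++⁻ˡ ear (Unique-++⁻ʳ pre (subst Unique p≡′ spine-unique)))
      (All.++⁻ˡ ear (All.++⁻ʳ pre (subst (All _) p≡′ spine⊆C)))
    where
    ear : List (Fin n)
    ear = a ∷ m ++ b ∷ []
    p≡′ : p ≡ pre ++ ear ++ post
    p≡′ = trans p≡ (cong (λ r → pre ++ a ∷ r) (sym (++-assoc m (b ∷ []) post)))
    spine⊆C : All (λ x → C x ≡ true) p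
    spine⊆C = spine⊆cluster tree cluster spine
    spine∈G[ν] : Linked (λ x y → pathEdges G T C u v x y ≡ true) p
    spine∈G[ν] = Linked-map-All (tree-edge∈pathEdges T⊆G) spine⊆C spine∈T

lemma6 : ∀ {n} (G : Graph n) (T : ESet n) → IsSpanningTree G T →
    ∀ (C : VSet n) (spine : List (Fin n)) (E : ESet n) →
    ClusterData G T C spine E →
    ∀ (BV : VSet n) (BE : ESet n) → IsBlock C E BV BE →
    Any (λ x → BV x ≡ true) spine →
    IsContiguousSubpath BV BE spine
lemma6 G T tree C _ _ (point u _) BV BE block (here u∈B) =
  [] , u ∷ [] , [] , refl , (λ ()) , [] , u∈B ∷ [] , [] , [-]
lemma6 G T tree C spine _ (path u v _ cluster spine-path) BV BE block hit =
  noGaps⇒contiguous (spine-noGaps G tree cluster spine-path block) hit
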